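{- For every odd integer $t\ge1$, $$h[-1]^t\mathbf{1}=\sum_{k\ge0}\binom{t}{2k}\frac{(2k)!}{k!(-24)^k}\,h(-1)^{t-2k}\mathbf{1}.$$
   Context: $S_{\mathrm{alg}}=\mathbb{Q}[h(-1),h(-2),\dots]$ (any field of characteristic zero) is the rank-one Heisenberg vertex operator algebra with vacuum $\mathbf{1}=1$: for $n<0$, $h(n)$ acts by multiplication, for $n\ge1$, $h(n)$ acts as $n\,\partial/\partial h(-n)$, and $h(0)$ acts as $0$. The square-bracket modes are $h[n]=\mathrm{Res}_z\, z^n e^z\sum_{m\in\mathbb{Z}}h(m)(e^z-1)^{ -m-1}$, with $(e^z-1)^{ -m-1}$ expanded as a Laurent series in $z$ (only finitely many $h(m)$, $m\ge0$, act nontrivially on a given state). In particular $h[-1]=\sum_{k\ge0}c_k h(k-1)$ where $c_k$ is the coefficient of $w^{k-1}$ in $(\log(1+w))^{ -1}$, i.e. $h[-1]=h(-1)+\frac12h(0)-\frac1{12}h(1)+\frac1{24}h(2)-\cdots$. -}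

module Defs where

open import Data.Nat as ℕ using (ℕ; zero; suc; _∸_; _!)
open import Data.Nat.Properties using (_!≢0; m^n≢0; m*n≢0)
open import Data.Nat.Combinatorics using (_C_)
open import Data.Integer as ℤ using (ℤ; +_; -[1+_])
open import Data.Rational as ℚ using (ℚ; 0ℚ; 1ℚ; _+_; _*_; -_; _/_)
open import Data.List using (List; []; _∷_; map; foldr; concat; upTo; _++_; length)
open import Data.Product using (_×_; _,_)
open import Data.Bool using (Bool; true; false; if_then_else_; _∧_)
open import Relation.Binary.PropositionalEquality using (_≡_)

-- A monomial is a list of exponents: position i holds the exponent of
-- the variable h(-(i+1)); missing trailing positions mean exponent 0.
-- A state (polynomial) is a finite formal ℚ-linear combination of
-- monomials, represented as a list of (coefficient, monomial) terms.

Monomial : Set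
Monomial = List ℕ

State : Set
State = List (ℚ × Monomial)

isZeroExp : Monomial → Bool
isZeroExp []            = true
isZeroExp (zero  ∷ m)   = isZeroExp m
isZeroExp (suc _ ∷ _)   = false

monoEq : Monomial → Monomial → Bool
monoEq []      m'       = isZeroExp m'
monoEq (e ∷ m) []       = isZeroExp (e ∷ m)
monoEq (e ∷ m) (e' ∷ m') = (e ℕ.≡ᵇ e') ∧ monoEq m m'

coeff : State → Monomial → ℚ
coeff []             _ = 0ℚ
coeff ((c , m) ∷ p) m' = (if monoEq m m' then c else 0ℚ) + coeff p m'

infix 4 _≈S_
_≈S_ : State → State → Set
p ≈S q = ∀ (m : Monomial) → coeff p m ≡ coeff q m

vac : State
vac = (1ℚ , []) ∷ []

_⊕_ : State → State → State
p ⊕ q = p ++ q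

_·_ : ℚ → State → State
a · p = map (λ { (c , m) → (a * c , m) }) p

sumS : List State → State
sumS = concat

expAt : ℕ → Monomial → ℕ
expAt _       []      = 0
expAt zero    (e ∷ _) = e
expAt (suc i) (_ ∷ m) = expAt i m

incAt : ℕ → Monomial → Monomial
incAt zero    []      = 1 ∷ []
incAt zero    (e ∷ m) = suc e ∷ m
incAt (suc i) []      = 0 ∷ incAt i []
incAt (suc i) (e ∷ m) = e ∷ incAt i m

decAt : ℕ → Monomial → Monomial
decAt _       []      = []
decAt zero    (e ∷ m) = (e ∸ 1) ∷ m
decAt (suc i) (e ∷ m) = e ∷ decAt i m

-- Heisenberg modes h(n), n ∈ ℤ:
--   h(-(i+1)) : multiplication by the variable h(-(i+1))
--   h(0)      : 0
--   h(i+1)    : (i+1) ∂/∂h(-(i+1))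
hmode : ℤ → State → State
hmode -[1+ i ]     p = map (λ { (c , m) → (c , incAt i m) }) p
hmode (+ zero)     p = []
hmode (+ (suc i))  p =
  map (λ { (c , m) → ((+ (suc i ℕ.* expAt i m) / 1) * c , decAt i m) }) p

-- The coefficients c_k: c_k is the coefficient of w^(k-1) in
-- (log(1+w))^(-1).  Writing log(1+w) = w · L(w) with
-- L(w) = Σ_j (-1)^j w^j/(j+1), we have (log(1+w))^(-1) = w^(-1) B(w)
-- where B = L^(-1) = Σ b_n w^n, so c_k = b_k, computed by the
-- recursion b_0 = 1, b_n = - Σ_{j=1}^n L_j b_{n-j}.

sgn : ℕ → ℤ
sgn zero    = + 1
sgn (suc n) = ℤ.- sgn n

Lcoef : ℕ → ℚ
Lcoef j = sgn j / suc j

-- bsRev n = b_n ∷ b_(n-1) ∷ ... ∷ b_0 ∷ []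
convSum : ℕ → List ℚ → ℚ
convSum _ []       = 0ℚ
convSum j (b ∷ bs) = Lcoef j * b + convSum (suc j) bs

bsRev : ℕ → List ℚ
bsRev zero    = 1ℚ ∷ []
bsRev (suc n) = (- convSum 1 (bsRev n)) ∷ bsRev n

headℚ : List ℚ → ℚ
headℚ []      = 0ℚ
headℚ (x ∷ _) = x

c : ℕ → ℚ
c k = headℚ (bsRev k)

-- The square-bracket mode h[-1] = Σ_{k≥0} c_k h(k-1).
-- On a state p, h(k-1) acts as 0 as soon as k-1 exceeds the number of
-- variables occurring in p, so the sum is truncated at k ≤ N(p)+1
-- (this truncation is exact, not an approximation).

maxLen : State → ℕ
maxLen = foldr (λ { (_ , m) r → length m ℕ.⊔ r }) 0

modeIdx : ℕ → ℤ
modeIdx zero    = -[1+ 0 ]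
modeIdx (suc k) = + k

hbr-1 : State → State
hbr-1 p = sumS (map (λ k → c k · hmode (modeIdx k) p) (upTo (suc (suc (maxLen p)))))

iter : ℕ → (State → State) → State → State
iter zero    f p = p
iter (suc n) f p = f (iter n f p)

h-1 : State → State
h-1 = hmode -[1+ 0 ]

rhsCoef : ℕ → ℕ → ℚ
rhsCoef t k =
  _/_ (sgn k ℤ.* + ((t C (2 ℕ.* k)) ℕ.* ((2 ℕ.* k) !))) (k ! ℕ.* (24 ℕ.^ k))
      {{m*n≢0 (k !) (24 ℕ.^ k) {{k !≢0}} {{m^n≢0 24 k}}}}

-- right-hand side  Σ_{k≥0} binom(t,2k)(2k)!/(k!(-24)^k) h(-1)^(t-2k) 1
-- (terms with 2k > t vanish since binom(t,2k) = 0; we sum k = 0..t)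
rhs : ℕ → State
rhs t = sumS (map (λ k → rhsCoef t k · iter (t ∸ 2 ℕ.* k) h-1 vac) (upTo (suc t)))

-- On polynomials in x = h(-1) alone, h(0) and every h(k) with k ≥ 2 act as 0 and h(1) acts as
-- d/dx, so h[-1] = x + c₂ d/dx there, with c₂ = -1/12.  Both sides of the identity lie in ℚ[x],
-- so it suffices to compare coefficients of the powers x^n.  The coefficients
-- a(t,k) = C(t,2k)(2k)!/(k!(-24)^k) obey a(t+1,k+1) = a(t,k+1) - (t-2k) a(t,k)/12, which is
-- Pascal's rule for the falling factorial t(t-1)⋯(t-2k+1), and this is exactly the recursion that
-- x + c₂ d/dx induces on Σₖ a(t,k) x^(t-2k).
module Submission where

open import Algebra.Bundles using (Ring)
open import Data.Bool using (Bool; true; false; T; if_then_else_; _∧_)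
import Data.Bool.Properties as BoolP
open import Data.Fin using (Fin; toℕ; fromℕ; inject₁)
import Data.Fin.Properties as FinP
open import Data.Integer as ℤ using (ℤ; +_; -[1+_])
import Data.Integer.Properties as ℤP
import Data.Integer.Solver as ℤS
open import Data.List using ([]; _∷_; map; applyUpTo; drop; length)
open import Data.List.Relation.Unary.All as All using (All; []; _∷_)
import Data.List.Relation.Unary.All.Properties as AllP
open import Data.Nat as ℕ using (ℕ; zero; suc; _∸_; _!; _≡ᵇ_; _%_)
open import Data.Nat.Combinatorics
  using (_C_; nCk≡n!/k![n-k]!; k![n∸k]!∣n!; k>n⇒nCk≡0; nCk+nC[k+1]≡[n+1]C[k+1])
open import Data.Nat.DivMod using (m/n*n≡m)
import Data.Nat.Properties as ℕP
import Data.Nat.Solver as ℕS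
open import Data.Product using (_,_; proj₂)
open import Data.Rational using (ℚ; 0ℚ; 1ℚ; _+_; _*_; _/_; toℚᵘ)
import Data.Rational.Properties as ℚP
import Data.Rational.Solver as ℚS
open import Data.Rational.Unnormalised as ℚᵘ using (mkℚᵘ; *≡*)
import Data.Rational.Unnormalised.Properties as ℚᵘP
open import Data.Unit using (tt)
open import Function using (_∘_)
open import Relation.Binary.PropositionalEquality
open import Relation.Nullary using (yes; no)

open import Algebra.Properties.Semiring.Sum (Ring.semiring ℚP.+-*-ring)
  using (sum-syntax; sum-cong-≗; sum-init-last; sum-replicate-zero; ∑-distrib-+; *-distribˡ-sum)

open import Defs

ι : ℤ → ℚ
ι z = z / 1

toℚᵘ-/ : ∀ z d → toℚᵘ (z / suc d) ℚᵘ.≃ mkℚᵘ z d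
toℚᵘ-/ z d = ℚP.toℚᵘ-fromℚᵘ (mkℚᵘ z d)

module _ where
  open ℚᵘP.≃-Reasoning

  ι-+ : ∀ a b → ι (a ℤ.+ b) ≡ ι a + ι b
  ι-+ a b = ℚP.toℚᵘ-injective (begin
    toℚᵘ (ι (a ℤ.+ b))         ≈⟨ toℚᵘ-/ (a ℤ.+ b) 0 ⟩
    mkℚᵘ (a ℤ.+ b) 0           ≈⟨ *≡* (solve 2 (λ a b → (a :+ b) :* con (+ 1) := (a :* con (+ 1) :+ b :* con (+ 1)) :* con (+ 1)) refl a b) ⟩
    mkℚᵘ a 0 ℚᵘ.+ mkℚᵘ b 0     ≈⟨ ℚᵘP.+-cong (toℚᵘ-/ a 0) (toℚᵘ-/ b 0) ⟨
    toℚᵘ (ι a) ℚᵘ.+ toℚᵘ (ι b) ≈⟨ ℚP.toℚᵘ-homo-+ (ι a) (ι b) ⟨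
    toℚᵘ (ι a + ι b) ∎)
    where open ℤS.+-*-Solver

  ι-* : ∀ a b → ι (a ℤ.* b) ≡ ι a * ι b
  ι-* a b = ℚP.toℚᵘ-injective (begin
    toℚᵘ (ι (a ℤ.* b))         ≈⟨ toℚᵘ-/ (a ℤ.* b) 0 ⟩
    mkℚᵘ (a ℤ.* b) 0           ≈⟨ *≡* refl ⟩
    mkℚᵘ a 0 ℚᵘ.* mkℚᵘ b 0     ≈⟨ ℚᵘP.*-cong (toℚᵘ-/ a 0) (toℚᵘ-/ b 0) ⟨
    toℚᵘ (ι a) ℚᵘ.* toℚᵘ (ι b) ≈⟨ ℚP.toℚᵘ-homo-* (ι a) (ι b) ⟨
    toℚᵘ (ι a * ι b) ∎)

  /≡ι*1/ : ∀ z n .{{_ : ℕ.NonZero n}} → z / n ≡ ι z * (+ 1 / n)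
  /≡ι*1/ z n@(suc d) = ℚP.toℚᵘ-injective (begin
    toℚᵘ (z / n)                   ≈⟨ toℚᵘ-/ z d ⟩
    mkℚᵘ z d                       ≈⟨ *≡* (cong₂ ℤ._*_ (sym (ℤP.*-identityʳ z)) (cong (λ e → + suc e) (ℕP.+-identityʳ d))) ⟩
    mkℚᵘ z 0 ℚᵘ.* mkℚᵘ (+ 1) d     ≈⟨ ℚᵘP.*-cong (toℚᵘ-/ z 0) (toℚᵘ-/ (+ 1) d) ⟨
    toℚᵘ (ι z) ℚᵘ.* toℚᵘ (+ 1 / n) ≈⟨ ℚP.toℚᵘ-homo-* (ι z) (+ 1 / n) ⟨
    toℚᵘ (ι z * (+ 1 / n)) ∎)

  1/[m*n]*n≡1/m : ∀ m n .{{_ : ℕ.NonZero m}} .{{_ : ℕ.NonZero n}} .{{_ : ℕ.NonZero (m ℕ.* n)}} →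
                  (+ 1 / (m ℕ.* n)) * ι (+ n) ≡ + 1 / m
  1/[m*n]*n≡1/m m@(suc m-1) n@(suc _) = ℚP.toℚᵘ-injective (begin
    toℚᵘ ((+ 1 / (m ℕ.* n)) * ι (+ n))              ≈⟨ ℚP.toℚᵘ-homo-* (+ 1 / (m ℕ.* n)) (ι (+ n)) ⟩
    toℚᵘ (+ 1 / (m ℕ.* n)) ℚᵘ.* toℚᵘ (ι (+ n))      ≈⟨ ℚᵘP.*-cong (toℚᵘ-/ (+ 1) (ℕ.pred (m ℕ.* n))) (toℚᵘ-/ (+ n) 0) ⟩
    mkℚᵘ (+ 1) (ℕ.pred (m ℕ.* n)) ℚᵘ.* mkℚᵘ (+ n) 0 ≈⟨ *≡* (cong +_ (solve 2 (λ m n → (con 1 :* n) :* m := con 1 :* ((m :* n) :* con 1)) refl m n)) ⟩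
    mkℚᵘ (+ 1) m-1                                  ≈⟨ toℚᵘ-/ (+ 1) m-1 ⟨
    toℚᵘ (+ 1 / m) ∎)
    where open ℕS.+-*-Solver

-- Falling factorials and the coefficients a(t,k) = rhsCoef t k

nCk*[k!*[n∸k]!]≡n! : ∀ {n k} → k ℕ.≤ n → (n C k) ℕ.* (k ! ℕ.* (n ∸ k) !) ≡ n !
nCk*[k!*[n∸k]!]≡n! {n} {k} k≤n =
  trans (cong (ℕ._* (k ! ℕ.* (n ∸ k) !)) (nCk≡n!/k![n-k]! k≤n)) (m/n*n≡m (k![n∸k]!∣n! k≤n))
  where instance _ = ℕP.m*n≢0 (k !) ((n ∸ k) !) {{k ℕP.!≢0}} {{(n ∸ k) ℕP.!≢0}}

nC[k+1]*[k+1]!≡nCk*k!*[n∸k] : ∀ n k → (n C suc k) ℕ.* suc k ! ≡ (n C k) ℕ.* k ! ℕ.* (n ∸ k)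
nC[k+1]*[k+1]!≡nCk*k!*[n∸k] n k with k ℕ.<? n
... | no k≮n = begin
  (n C suc k) ℕ.* suc k !     ≡⟨ cong (ℕ._* suc k !) (k>n⇒nCk≡0 (ℕ.s≤s n≤k)) ⟩
  0                           ≡⟨ ℕP.*-zeroʳ ((n C k) ℕ.* k !) ⟨
  (n C k) ℕ.* k ! ℕ.* 0       ≡⟨ cong ((n C k) ℕ.* k ! ℕ.*_) (ℕP.m≤n⇒m∸n≡0 n≤k) ⟨
  (n C k) ℕ.* k ! ℕ.* (n ∸ k) ∎
  where
  open ≡-Reasoning
  n≤k = ℕP.≮⇒≥ k≮n
... | yes k<n = ℕP.*-cancelʳ-≡ _ _ (r !) {{r ℕP.!≢0}} (begin
  (n C suc k) ℕ.* suc k ! ℕ.* r !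
    ≡⟨ ℕP.*-assoc (n C suc k) (suc k !) (r !) ⟩
  (n C suc k) ℕ.* (suc k ! ℕ.* r !)
    ≡⟨ nCk*[k!*[n∸k]!]≡n! k<n ⟩
  n !
    ≡⟨ nCk*[k!*[n∸k]!]≡n! (ℕP.<⇒≤ k<n) ⟨
  (n C k) ℕ.* (k ! ℕ.* (n ∸ k) !)
    ≡⟨ cong (λ m → (n C k) ℕ.* (k ! ℕ.* m !)) n∸k≡1+r ⟩
  (n C k) ℕ.* (k ! ℕ.* suc r !)
    ≡⟨ solve 4 (λ a b c d → a :* (b :* ((con 1 :+ c) :* d)) := a :* b :* (con 1 :+ c) :* d) refl (n C k) (k !) r (r !) ⟩
  (n C k) ℕ.* k ! ℕ.* suc r ℕ.* r !
    ≡⟨ cong (λ m → (n C k) ℕ.* k ! ℕ.* m ℕ.* r !) n∸k≡1+r ⟨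
  (n C k) ℕ.* k ! ℕ.* (n ∸ k) ℕ.* r ! ∎)
  where
  open ≡-Reasoning
  open ℕS.+-*-Solver
  r = n ∸ suc k
  n∸k≡1+r : n ∸ k ≡ suc r
  n∸k≡1+r = ℕP.+-∸-assoc 1 k<n

fallingEven : ℕ → ℕ → ℕ
fallingEven t k = (t C (2 ℕ.* k)) ℕ.* (2 ℕ.* k) !

fallingEven-suc : ∀ t k → fallingEven (suc t) (suc k) ≡
                  fallingEven t (suc k) ℕ.+ 2 ℕ.* (suc k ℕ.* ((t ∸ 2 ℕ.* k) ℕ.* fallingEven t k))
fallingEven-suc t k = begin
  fallingEven (suc t) (suc k)
    ≡⟨ cong (λ x → (suc t C x) ℕ.* x !) 2[1+k]≡2+2k ⟩
  (suc t C j+2) ℕ.* j+2 !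
    ≡⟨ cong (ℕ._* j+2 !) (nCk+nC[k+1]≡[n+1]C[k+1] t (suc j)) ⟨
  ((t C suc j) ℕ.+ (t C j+2)) ℕ.* j+2 !
    ≡⟨ solve 4 (λ a b s f → (a :+ b) :* (s :* f) := b :* (s :* f) :+ s :* (a :* f)) refl (t C suc j) (t C j+2) j+2 (suc j !) ⟩
  (t C j+2) ℕ.* j+2 ! ℕ.+ j+2 ℕ.* ((t C suc j) ℕ.* suc j !)
    ≡⟨ cong (λ x → (t C x) ℕ.* x ! ℕ.+ x ℕ.* ((t C suc j) ℕ.* suc j !)) 2[1+k]≡2+2k ⟨
  fallingEven t (suc k) ℕ.+ 2 ℕ.* suc k ℕ.* ((t C suc j) ℕ.* suc j !)
    ≡⟨ cong (λ x → fallingEven t (suc k) ℕ.+ 2 ℕ.* suc k ℕ.* x) (nC[k+1]*[k+1]!≡nCk*k!*[n∸k] t j) ⟩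
  fallingEven t (suc k) ℕ.+ 2 ℕ.* suc k ℕ.* ((t C j) ℕ.* j ! ℕ.* (t ∸ j))
    ≡⟨ cong (fallingEven t (suc k) ℕ.+_) (solve 4 (λ k a b m → (con 2 :* (con 1 :+ k)) :* (a :* b :* m) := con 2 :* ((con 1 :+ k) :* (m :* (a :* b)))) refl k (t C j) (j !) (t ∸ j)) ⟩
  fallingEven t (suc k) ℕ.+ 2 ℕ.* (suc k ℕ.* ((t ∸ j) ℕ.* fallingEven t k)) ∎
  where
  open ≡-Reasoning
  open ℕS.+-*-Solver
  j = 2 ℕ.* k
  j+2 = suc (suc j)
  2[1+k]≡2+2k : 2 ℕ.* suc k ≡ j+2
  2[1+k]≡2+2k = ℕP.*-suc 2 k

numer : ℕ → ℕ → ℤ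
numer t k = sgn k ℤ.* + fallingEven t k

numer-suc : ∀ t k → numer (suc t) (suc k) ≡
            numer t (suc k) ℤ.+ -[1+ 1 ] ℤ.* (+ suc k ℤ.* (+ (t ∸ 2 ℕ.* k) ℤ.* numer t k))
numer-suc t k = begin
  ℤ.- sgn k ℤ.* + fallingEven (suc t) (suc k)
    ≡⟨ cong (λ x → ℤ.- sgn k ℤ.* + x) (fallingEven-suc t k) ⟩
  ℤ.- sgn k ℤ.* + (F′ ℕ.+ 2 ℕ.* (suc k ℕ.* (m ℕ.* F)))
    ≡⟨ cong (ℤ.- sgn k ℤ.*_) cast ⟩
  ℤ.- sgn k ℤ.* (+ F′ ℤ.+ + 2 ℤ.* (+ suc k ℤ.* (+ m ℤ.* + F)))
    ≡⟨ solve 5 (λ s a b c d → (:- s) :* (a :+ con (+ 2) :* (b :* (c :* d))) := (:- s) :* a :+ con -[1+ 1 ] :* (b :* (c :* (s :* d)))) refl (sgn k) (+ F′) (+ suc k) (+ m) (+ F) ⟩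
  numer t (suc k) ℤ.+ -[1+ 1 ] ℤ.* (+ suc k ℤ.* (+ m ℤ.* numer t k)) ∎
  where
  open ≡-Reasoning
  open ℤS.+-*-Solver
  F′ = fallingEven t (suc k)
  F = fallingEven t k
  m = t ∸ 2 ℕ.* k
  cast : + (F′ ℕ.+ 2 ℕ.* (suc k ℕ.* (m ℕ.* F))) ≡ + F′ ℤ.+ + 2 ℤ.* (+ suc k ℤ.* (+ m ℤ.* + F))
  cast = begin
    + (F′ ℕ.+ 2 ℕ.* (suc k ℕ.* (m ℕ.* F)))       ≡⟨ ℤP.pos-+ F′ (2 ℕ.* (suc k ℕ.* (m ℕ.* F))) ⟩
    + F′ ℤ.+ + (2 ℕ.* (suc k ℕ.* (m ℕ.* F)))     ≡⟨ cong (ℤ._+_ (+ F′)) (ℤP.pos-* 2 (suc k ℕ.* (m ℕ.* F))) ⟩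
    + F′ ℤ.+ + 2 ℤ.* + (suc k ℕ.* (m ℕ.* F))     ≡⟨ cong (λ x → + F′ ℤ.+ + 2 ℤ.* x) (ℤP.pos-* (suc k) (m ℕ.* F)) ⟩
    + F′ ℤ.+ + 2 ℤ.* (+ suc k ℤ.* + (m ℕ.* F))   ≡⟨ cong (λ x → + F′ ℤ.+ + 2 ℤ.* (+ suc k ℤ.* x)) (ℤP.pos-* m F) ⟩
    + F′ ℤ.+ + 2 ℤ.* (+ suc k ℤ.* (+ m ℤ.* + F)) ∎

denom : ℕ → ℕ
denom k = k ! ℕ.* 24 ℕ.^ k

denom≢0 : ∀ k → ℕ.NonZero (denom k)
denom≢0 k = ℕP.m*n≢0 (k !) (24 ℕ.^ k) {{k ℕP.!≢0}} {{ℕP.m^n≢0 24 k}}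

1/denom : ℕ → ℚ
1/denom k = (+ 1 / denom k) {{denom≢0 k}}

rhsCoef≡ι[numer]*1/denom : ∀ t k → rhsCoef t k ≡ ι (numer t k) * 1/denom k
rhsCoef≡ι[numer]*1/denom t k = /≡ι*1/ (numer t k) (denom k) {{denom≢0 k}}

1/denom-suc : ∀ k → 1/denom k ≡ 1/denom (suc k) * ι (+ (suc k ℕ.* 24))
1/denom-suc k = sym (begin
  1/denom (suc k) * ι (+ n)                  ≡⟨ cong (_* ι (+ n)) (ℚP./-cong {p₁ = + 1} {{denom≢0 (suc k)}} {{dn≢0}} refl denom-suc) ⟩
  (+ 1 / (denom k ℕ.* n)) {{dn≢0}} * ι (+ n) ≡⟨ 1/[m*n]*n≡1/m (denom k) n {{denom≢0 k}} {{_}} {{dn≢0}} ⟩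
  1/denom k ∎)
  where
  open ≡-Reasoning
  open ℕS.+-*-Solver
  n = suc k ℕ.* 24
  dn≢0 = ℕP.m*n≢0 (denom k) n {{denom≢0 k}}
  denom-suc : denom (suc k) ≡ denom k ℕ.* n
  denom-suc = solve 3 (λ k f p → ((con 1 :+ k) :* f) :* (con 24 :* p) := (f :* p) :* ((con 1 :+ k) :* con 24)) refl k (k !) (24 ℕ.^ k)

-- c 2 evaluates to -1/12.
c₂*24≡-2 : c 2 * ι (+ 24) ≡ ι -[1+ 1 ]
c₂*24≡-2 = refl

rhsCoef-suc : ∀ t k → rhsCoef (suc t) (suc k) ≡ rhsCoef t (suc k) + c 2 * (ι (+ (t ∸ 2 ℕ.* k)) * rhsCoef t k)
rhsCoef-suc t k = begin
  rhsCoef (suc t) (suc k)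
    ≡⟨ rhsCoef≡ι[numer]*1/denom (suc t) (suc k) ⟩
  ι (numer (suc t) (suc k)) * u
    ≡⟨ cong (λ x → ι x * u) (numer-suc t k) ⟩
  ι (A ℤ.+ -[1+ 1 ] ℤ.* (+ suc k ℤ.* (+ m ℤ.* B))) * u
    ≡⟨ cong (_* u) expand ⟩
  (ι A + c 2 * ι (+ 24) * (ι (+ suc k) * (ι (+ m) * ι B))) * u
    ≡⟨ solve 7 (λ a c₂ i24 s m b u → (a :+ c₂ :* i24 :* (s :* (m :* b))) :* u := a :* u :+ c₂ :* (m :* (b :* (u :* (s :* i24))))) refl (ι A) (c 2) (ι (+ 24)) (ι (+ suc k)) (ι (+ m)) (ι B) u ⟩
  ι A * u + c 2 * (ι (+ m) * (ι B * (u * (ι (+ suc k) * ι (+ 24)))))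
    ≡⟨ cong (λ x → ι A * u + c 2 * (ι (+ m) * (ι B * (u * x)))) (trans (sym (ι-* (+ suc k) (+ 24))) (cong ι (sym (ℤP.pos-* (suc k) 24)))) ⟩
  ι A * u + c 2 * (ι (+ m) * (ι B * (u * ι (+ (suc k ℕ.* 24)))))
    ≡⟨ cong (λ x → ι A * u + c 2 * (ι (+ m) * (ι B * x))) (1/denom-suc k) ⟨
  ι A * u + c 2 * (ι (+ m) * (ι B * 1/denom k))
    ≡⟨ cong₂ (λ x y → x + c 2 * (ι (+ m) * y)) (rhsCoef≡ι[numer]*1/denom t (suc k)) (rhsCoef≡ι[numer]*1/denom t k) ⟨
  rhsCoef t (suc k) + c 2 * (ι (+ m) * rhsCoef t k) ∎
  where
  open ≡-Reasoning
  open ℚS.+-*-Solver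
  m = t ∸ 2 ℕ.* k
  A = numer t (suc k)
  B = numer t k
  u = 1/denom (suc k)
  expand : ι (A ℤ.+ -[1+ 1 ] ℤ.* (+ suc k ℤ.* (+ m ℤ.* B))) ≡ ι A + c 2 * ι (+ 24) * (ι (+ suc k) * (ι (+ m) * ι B))
  expand = begin
    ι (A ℤ.+ -[1+ 1 ] ℤ.* (+ suc k ℤ.* (+ m ℤ.* B)))       ≡⟨ ι-+ A (-[1+ 1 ] ℤ.* (+ suc k ℤ.* (+ m ℤ.* B))) ⟩
    ι A + ι (-[1+ 1 ] ℤ.* (+ suc k ℤ.* (+ m ℤ.* B)))       ≡⟨ cong (_+_ (ι A)) (ι-* -[1+ 1 ] (+ suc k ℤ.* (+ m ℤ.* B))) ⟩
    ι A + ι -[1+ 1 ] * ι (+ suc k ℤ.* (+ m ℤ.* B))         ≡⟨ cong (λ x → ι A + ι -[1+ 1 ] * x) (ι-* (+ suc k) (+ m ℤ.* B)) ⟩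
    ι A + ι -[1+ 1 ] * (ι (+ suc k) * ι (+ m ℤ.* B))       ≡⟨ cong (λ x → ι A + ι -[1+ 1 ] * (ι (+ suc k) * x)) (ι-* (+ m) B) ⟩
    ι A + ι -[1+ 1 ] * (ι (+ suc k) * (ι (+ m) * ι B))     ≡⟨ cong (λ x → ι A + x * (ι (+ suc k) * (ι (+ m) * ι B))) c₂*24≡-2 ⟨
    ι A + c 2 * ι (+ 24) * (ι (+ suc k) * (ι (+ m) * ι B)) ∎

t<2k⇒rhsCoef≡0 : ∀ {t k} → t ℕ.< 2 ℕ.* k → rhsCoef t k ≡ 0ℚ
t<2k⇒rhsCoef≡0 {t} {k} t<2k = begin
  rhsCoef t k                                                 ≡⟨ rhsCoef≡ι[numer]*1/denom t k ⟩
  ι (sgn k ℤ.* + ((t C 2 ℕ.* k) ℕ.* (2 ℕ.* k) !)) * 1/denom k ≡⟨ cong (λ x → ι (sgn k ℤ.* + (x ℕ.* (2 ℕ.* k) !)) * 1/denom k) (k>n⇒nCk≡0 t<2k) ⟩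
  ι (sgn k ℤ.* + 0) * 1/denom k                               ≡⟨ cong (λ x → ι x * 1/denom k) (ℤP.*-zeroʳ (sgn k)) ⟩
  0ℚ * 1/denom k                                              ≡⟨ ℚP.*-zeroˡ (1/denom k) ⟩
  0ℚ ∎
  where open ≡-Reasoning

-- Coefficient sequences in x = h(-1)

sum-drop-last : ∀ N (f : ℕ → ℚ) → f N ≡ 0ℚ → ∑[ k < suc N ] f (toℕ k) ≡ ∑[ k < N ] f (toℕ k)
sum-drop-last N f fN≡0 = begin
  ∑[ k < suc N ] f (toℕ k)
    ≡⟨ sum-init-last {N} (λ k → f (toℕ k)) ⟩
  ∑[ k < N ] f (toℕ (inject₁ k)) + f (toℕ (fromℕ N))
    ≡⟨ cong₂ _+_ (sum-cong-≗ {N} (λ k → cong f (FinP.toℕ-inject₁ k))) (trans (cong f (FinP.toℕ-fromℕ N)) fN≡0) ⟩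
  ∑[ k < N ] f (toℕ k) + 0ℚ
    ≡⟨ ℚP.+-identityʳ _ ⟩
  ∑[ k < N ] f (toℕ k) ∎
  where open ≡-Reasoning

δ : ℕ → ℕ → ℚ
δ j n = if j ≡ᵇ n then 1ℚ else 0ℚ

mulX : (ℕ → ℚ) → ℕ → ℚ
mulX f zero    = 0ℚ
mulX f (suc n) = f n

diff : (ℕ → ℚ) → ℕ → ℚ
diff f n = ι (+ suc n) * f (suc n)

hbr-1-seq : (ℕ → ℚ) → ℕ → ℚ
hbr-1-seq f n = mulX f n + c 2 * diff f n

hbr-1-seq-cong : ∀ {f g} → (∀ n → f n ≡ g n) → ∀ n → hbr-1-seq f n ≡ hbr-1-seq g n
hbr-1-seq-cong f≗g zero    = cong (λ x → 0ℚ + c 2 * (ι (+ 1) * x)) (f≗g 1)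
hbr-1-seq-cong f≗g (suc n) = cong₂ (λ x y → x + c 2 * (ι (+ suc (suc n)) * y)) (f≗g n) (f≗g (suc (suc n)))

mulX-*ˡ : ∀ a f n → a * mulX f n ≡ mulX (λ m → a * f m) n
mulX-*ˡ a f zero    = ℚP.*-zeroʳ a
mulX-*ˡ a f (suc n) = refl

diff-*ˡ : ∀ a f n → a * diff f n ≡ diff (λ m → a * f m) n
diff-*ˡ a f n = solve 3 (λ a x y → a :* (x :* y) := x :* (a :* y)) refl a (ι (+ suc n)) (f (suc n))
  where open ℚS.+-*-Solver

mulX-sum : ∀ {N} (f : Fin N → ℕ → ℚ) n → mulX (λ m → ∑[ k < N ] f k m) n ≡ ∑[ k < N ] mulX (f k) n
mulX-sum {N} f zero    = sym (sum-replicate-zero N)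
mulX-sum     f (suc n) = refl

diff-sum : ∀ {N} (f : Fin N → ℕ → ℚ) n → diff (λ m → ∑[ k < N ] f k m) n ≡ ∑[ k < N ] diff (f k) n
diff-sum f n = *-distribˡ-sum (ι (+ suc n)) (λ k → f k (suc n))

mulX-δ : ∀ j n → δ (suc j) n ≡ mulX (δ j) n
mulX-δ j zero    = refl
mulX-δ j (suc n) = refl

diff-δ : ∀ j n → ι (+ j) * δ (j ∸ 1) n ≡ diff (δ j) n
diff-δ zero    n = trans (ℚP.*-zeroˡ (δ 0 n)) (sym (ℚP.*-zeroʳ (ι (+ suc n))))
diff-δ (suc j) n with j ≡ᵇ n in j≡ᵇn
... | true  = cong (λ m → ι (+ suc m) * 1ℚ) (ℕP.≡ᵇ⇒≡ j n (subst T (sym j≡ᵇn) tt))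
... | false = trans (ℚP.*-zeroʳ (ι (+ suc j))) (sym (ℚP.*-zeroʳ (ι (+ suc n))))

term : ℕ → ℕ → ℕ → ℚ
term t k = λ n → rhsCoef t k * δ (t ∸ 2 ℕ.* k) n

rhsSeq : ℕ → ℕ → ℚ
rhsSeq t n = ∑[ k < suc t ] term t (toℕ k) n

≡0⇒*-congˡ : ∀ {a} y z → a ≡ 0ℚ → a * y ≡ a * z
≡0⇒*-congˡ y z refl = trans (ℚP.*-zeroˡ y) (sym (ℚP.*-zeroˡ z))

term-mulX : ∀ t k n → rhsCoef t k * δ (suc t ∸ 2 ℕ.* k) n ≡ mulX (term t k) n
term-mulX t k n = trans shift (mulX-*ˡ (rhsCoef t k) (δ (t ∸ 2 ℕ.* k)) n)
  where
  shift : rhsCoef t k * δ (suc t ∸ 2 ℕ.* k) n ≡ rhsCoef t k * mulX (δ (t ∸ 2 ℕ.* k)) n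
  shift with 2 ℕ.* k ℕ.≤? t
  ... | yes 2k≤t = cong (rhsCoef t k *_) (trans (cong (λ j → δ j n) (ℕP.+-∸-assoc 1 2k≤t)) (mulX-δ (t ∸ 2 ℕ.* k) n))
  ... | no 2k≰t  = ≡0⇒*-congˡ (δ (suc t ∸ 2 ℕ.* k) n) (mulX (δ (t ∸ 2 ℕ.* k)) n) (t<2k⇒rhsCoef≡0 {t} {k} (ℕP.≰⇒> 2k≰t))

term-diff : ∀ t k n → c 2 * (ι (+ (t ∸ 2 ℕ.* k)) * rhsCoef t k) * δ (t ∸ 2 ℕ.* k ∸ 1) n ≡ c 2 * diff (term t k) n
term-diff t k n = begin
  c 2 * (ι (+ j) * a) * δ (j ∸ 1) n   ≡⟨ solve 4 (λ c₂ x a d → c₂ :* (x :* a) :* d := c₂ :* (a :* (x :* d))) refl (c 2) (ι (+ j)) a (δ (j ∸ 1) n) ⟩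
  c 2 * (a * (ι (+ j) * δ (j ∸ 1) n)) ≡⟨ cong (λ x → c 2 * (a * x)) (diff-δ j n) ⟩
  c 2 * (a * diff (δ j) n)            ≡⟨ cong (c 2 *_) (diff-*ˡ a (δ j) n) ⟩
  c 2 * diff (term t k) n ∎
  where
  open ≡-Reasoning
  open ℚS.+-*-Solver
  j = t ∸ 2 ℕ.* k
  a = rhsCoef t k

term-suc : ∀ t k n → term (suc t) (suc k) n ≡
           rhsCoef t (suc k) * δ (suc t ∸ 2 ℕ.* suc k) n + c 2 * (ι (+ (t ∸ 2 ℕ.* k)) * rhsCoef t k) * δ (t ∸ 2 ℕ.* k ∸ 1) n
term-suc t k n = begin
  rhsCoef (suc t) (suc k) * δ j n                         ≡⟨ cong (_* δ j n) (rhsCoef-suc t k) ⟩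
  (rhsCoef t (suc k) + b) * δ j n                         ≡⟨ ℚP.*-distribʳ-+ (δ j n) (rhsCoef t (suc k)) b ⟩
  rhsCoef t (suc k) * δ j n + b * δ j n                   ≡⟨ cong (λ i → rhsCoef t (suc k) * δ j n + b * δ i n) 1+t∸2[1+k]≡t∸2k∸1 ⟩
  rhsCoef t (suc k) * δ j n + b * δ (t ∸ 2 ℕ.* k ∸ 1) n ∎
  where
  open ≡-Reasoning
  j = suc t ∸ 2 ℕ.* suc k
  b = c 2 * (ι (+ (t ∸ 2 ℕ.* k)) * rhsCoef t k)
  1+t∸2[1+k]≡t∸2k∸1 : suc t ∸ 2 ℕ.* suc k ≡ t ∸ 2 ℕ.* k ∸ 1
  1+t∸2[1+k]≡t∸2k∸1 = begin
    suc t ∸ 2 ℕ.* suc k       ≡⟨ cong (suc t ∸_) (ℕP.*-suc 2 k) ⟩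
    t ∸ suc (2 ℕ.* k)         ≡⟨ cong (t ∸_) (ℕP.+-comm 1 (2 ℕ.* k)) ⟩
    t ∸ (2 ℕ.* k ℕ.+ 1)       ≡⟨ ℕP.∸-+-assoc t (2 ℕ.* k) 1 ⟨
    t ∸ 2 ℕ.* k ∸ 1 ∎

rhsSeq-mulX : ∀ t n → ∑[ k < suc (suc t) ] (rhsCoef t (toℕ k) * δ (suc t ∸ 2 ℕ.* toℕ k) n) ≡ mulX (rhsSeq t) n
rhsSeq-mulX t n = begin
  ∑[ k < suc (suc t) ] g (toℕ k)        ≡⟨ sum-drop-last (suc t) g last≡0 ⟩
  ∑[ k < suc t ] g (toℕ k)              ≡⟨ sum-cong-≗ {suc t} (λ k → term-mulX t (toℕ k) n) ⟩
  ∑[ k < suc t ] mulX (term t (toℕ k)) n ≡⟨ mulX-sum {suc t} (λ k → term t (toℕ k)) n ⟨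
  mulX (rhsSeq t) n ∎
  where
  open ≡-Reasoning
  g : ℕ → ℚ
  g k = rhsCoef t k * δ (suc t ∸ 2 ℕ.* k) n
  t<2[1+t] : t ℕ.< 2 ℕ.* suc t
  t<2[1+t] = ℕP.≤-trans (ℕP.n<1+n t) (ℕP.m≤m+n (suc t) (suc t ℕ.+ 0))
  last≡0 : g (suc t) ≡ 0ℚ
  last≡0 = trans (cong (_* δ (suc t ∸ 2 ℕ.* suc t) n) (t<2k⇒rhsCoef≡0 {t} {suc t} t<2[1+t])) (ℚP.*-zeroˡ (δ (suc t ∸ 2 ℕ.* suc t) n))

rhsSeq-diff : ∀ t n → ∑[ k < suc t ] (c 2 * (ι (+ (t ∸ 2 ℕ.* toℕ k)) * rhsCoef t (toℕ k)) * δ (t ∸ 2 ℕ.* toℕ k ∸ 1) n) ≡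
                      c 2 * diff (rhsSeq t) n
rhsSeq-diff t n = begin
  ∑[ k < suc t ] (c 2 * (ι (+ (t ∸ 2 ℕ.* toℕ k)) * rhsCoef t (toℕ k)) * δ (t ∸ 2 ℕ.* toℕ k ∸ 1) n)
                                               ≡⟨ sum-cong-≗ {suc t} (λ k → term-diff t (toℕ k) n) ⟩
  ∑[ k < suc t ] (c 2 * diff (term t (toℕ k)) n) ≡⟨ *-distribˡ-sum {suc t} (c 2) (λ k → diff (term t (toℕ k)) n) ⟨
  c 2 * ∑[ k < suc t ] diff (term t (toℕ k)) n   ≡⟨ cong (c 2 *_) (diff-sum {suc t} (λ k → term t (toℕ k)) n) ⟨
  c 2 * diff (rhsSeq t) n ∎
  where open ≡-Reasoning

rhsSeq-suc : ∀ t n → rhsSeq (suc t) n ≡ hbr-1-seq (rhsSeq t) n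
rhsSeq-suc t n = begin
  rhsSeq (suc t) n
    ≡⟨ cong (_+_ (term (suc t) 0 n)) (sum-cong-≗ {suc t} (λ k → term-suc t (toℕ k) n)) ⟩
  term (suc t) 0 n + ∑[ k < suc t ] (shifted (toℕ k) + derived (toℕ k))
    ≡⟨ cong (_+_ (term (suc t) 0 n)) (∑-distrib-+ {suc t} (shifted ∘ toℕ) (derived ∘ toℕ)) ⟩
  term (suc t) 0 n + (∑[ k < suc t ] shifted (toℕ k) + ∑[ k < suc t ] derived (toℕ k))
    ≡⟨ ℚP.+-assoc (term (suc t) 0 n) _ _ ⟨
  ∑[ k < suc (suc t) ] shifted′ (toℕ k) + ∑[ k < suc t ] derived (toℕ k)
    ≡⟨ cong₂ _+_ (rhsSeq-mulX t n) (rhsSeq-diff t n) ⟩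
  hbr-1-seq (rhsSeq t) n ∎
  where
  open ≡-Reasoning
  shifted′ shifted derived : ℕ → ℚ
  shifted′ k = rhsCoef t k * δ (suc t ∸ 2 ℕ.* k) n
  shifted k = shifted′ (suc k)
  derived k = c 2 * (ι (+ (t ∸ 2 ℕ.* k)) * rhsCoef t k) * δ (t ∸ 2 ℕ.* k ∸ 1) n

-- States that are polynomials in h(-1)

coeff₁ : State → ℕ → ℚ
coeff₁ p n = coeff p (n ∷ [])

if-*ˡ : ∀ (b : Bool) a x → (if b then a * x else 0ℚ) ≡ a * (if b then x else 0ℚ)
if-*ˡ true  a x = refl
if-*ˡ false a x = sym (ℚP.*-zeroʳ a)

coeff-⊕ : ∀ p q m → coeff (p ⊕ q) m ≡ coeff p m + coeff q m
coeff-⊕ []             q m = sym (ℚP.+-identityˡ (coeff q m))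
coeff-⊕ ((a , mo) ∷ p) q m = trans (cong (_+_ x) (coeff-⊕ p q m)) (sym (ℚP.+-assoc x (coeff p m) (coeff q m)))
  where x = if monoEq mo m then a else 0ℚ

coeff-· : ∀ a p m → coeff (a · p) m ≡ a * coeff p m
coeff-· a []             m = sym (ℚP.*-zeroʳ a)
coeff-· a ((b , mo) ∷ p) m =
  trans (cong₂ _+_ (if-*ˡ (monoEq mo m) a b) (coeff-· a p m)) (sym (ℚP.*-distribˡ-+ a _ _))

coeff-sumS-applyUpTo : ∀ (F : ℕ → State) g N m →
                       coeff (sumS (map F (applyUpTo g N))) m ≡ ∑[ k < N ] coeff (F (g (toℕ k))) m
coeff-sumS-applyUpTo F g zero    m = refl
coeff-sumS-applyUpTo F g (suc N) m =
  trans (coeff-⊕ (F (g 0)) (sumS (map F (applyUpTo (g ∘ suc) N))) m)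
        (cong (_+_ (coeff (F (g 0)) m)) (coeff-sumS-applyUpTo F (g ∘ suc) N m))

monoEq-incAt-zero : ∀ mo → monoEq (incAt 0 mo) (0 ∷ []) ≡ false
monoEq-incAt-zero []       = refl
monoEq-incAt-zero (e ∷ mo) = refl

monoEq-incAt-suc : ∀ mo n → monoEq (incAt 0 mo) (suc n ∷ []) ≡ monoEq mo (n ∷ [])
monoEq-incAt-suc []       zero    = refl
monoEq-incAt-suc []       (suc n) = refl
monoEq-incAt-suc (e ∷ mo) n       = refl

coeff₁-h-1 : ∀ p n → coeff₁ (h-1 p) n ≡ mulX (coeff₁ p) n
coeff₁-h-1 []             zero    = refl
coeff₁-h-1 []             (suc n) = refl
coeff₁-h-1 ((a , mo) ∷ p) zero    =
  cong₂ _+_ (cong (λ b → if b then a else 0ℚ) (monoEq-incAt-zero mo)) (coeff₁-h-1 p 0)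
coeff₁-h-1 ((a , mo) ∷ p) (suc n) =
  cong₂ _+_ (cong (λ b → if b then a else 0ℚ) (monoEq-incAt-suc mo n)) (coeff₁-h-1 p (suc n))

scale-if-≡ᵇ : ∀ e n b a → ι (+ e) * (if (e ≡ᵇ n) ∧ b then a else 0ℚ) ≡ ι (+ n) * (if (e ≡ᵇ n) ∧ b then a else 0ℚ)
scale-if-≡ᵇ e n b a with e ≡ᵇ n in e≡ᵇn
... | true  = cong (λ m → ι (+ m) * (if b then a else 0ℚ)) (ℕP.≡ᵇ⇒≡ e n (subst T (sym e≡ᵇn) tt))
... | false = trans (ℚP.*-zeroʳ (ι (+ e))) (sym (ℚP.*-zeroʳ (ι (+ n))))

coeff₁-h1-term : ∀ a mo n → (if monoEq (decAt 0 mo) (n ∷ []) then ι (+ (1 ℕ.* expAt 0 mo)) * a else 0ℚ) ≡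
                             ι (+ suc n) * (if monoEq mo (suc n ∷ []) then a else 0ℚ)
coeff₁-h1-term a []           zero    = trans (ℚP.*-zeroˡ a) (sym (ℚP.*-zeroʳ (ι (+ 1))))
coeff₁-h1-term a []           (suc n) = sym (ℚP.*-zeroʳ (ι (+ suc (suc n))))
coeff₁-h1-term a (zero ∷ mo)  n       = begin
  (if b then ι (+ 0) * a else 0ℚ) ≡⟨ if-*ˡ b (ι (+ 0)) a ⟩
  ι (+ 0) * (if b then a else 0ℚ) ≡⟨ ℚP.*-zeroˡ (if b then a else 0ℚ) ⟩
  0ℚ                              ≡⟨ ℚP.*-zeroʳ (ι (+ suc n)) ⟨
  ι (+ suc n) * 0ℚ ∎
  where
  open ≡-Reasoning
  b = (0 ≡ᵇ n) ∧ monoEq mo []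
coeff₁-h1-term a (suc e ∷ mo) n       = begin
  (if b then ι (+ (1 ℕ.* suc e)) * a else 0ℚ) ≡⟨ if-*ˡ b (ι (+ (1 ℕ.* suc e))) a ⟩
  ι (+ (1 ℕ.* suc e)) * (if b then a else 0ℚ) ≡⟨ cong (λ x → ι (+ x) * (if b then a else 0ℚ)) (ℕP.*-identityˡ (suc e)) ⟩
  ι (+ suc e) * (if b then a else 0ℚ)         ≡⟨ scale-if-≡ᵇ (suc e) (suc n) (monoEq mo []) a ⟩
  ι (+ suc n) * (if b then a else 0ℚ) ∎
  where
  open ≡-Reasoning
  b = (e ≡ᵇ n) ∧ monoEq mo []

coeff₁-h1 : ∀ p n → coeff₁ (hmode (+ 1) p) n ≡ diff (coeff₁ p) n
coeff₁-h1 []             n = sym (ℚP.*-zeroʳ (ι (+ suc n)))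
coeff₁-h1 ((a , mo) ∷ p) n =
  trans (cong₂ _+_ (coeff₁-h1-term a mo n) (coeff₁-h1 p n)) (sym (ℚP.*-distribˡ-+ (ι (+ suc n)) _ _))

maxLen≡0⇒coeff₁-suc≡0 : ∀ p n → maxLen p ≡ 0 → coeff₁ p (suc n) ≡ 0ℚ
maxLen≡0⇒coeff₁-suc≡0 []                 n _     = refl
maxLen≡0⇒coeff₁-suc≡0 ((a , []) ∷ p)     n len≡0 =
  trans (ℚP.+-identityˡ (coeff₁ p (suc n))) (maxLen≡0⇒coeff₁-suc≡0 p n len≡0)
maxLen≡0⇒coeff₁-suc≡0 ((a , e ∷ mo) ∷ p) n len≡0
  with () ← subst (suc (length mo) ℕ.≤_) len≡0 (ℕP.m≤m⊔n _ (maxLen p))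

Univariate : Monomial → Set
Univariate mo = isZeroExp (drop 1 mo) ≡ true

UnivariateState : State → Set
UnivariateState = All (Univariate ∘ proj₂)

isZeroExp⇒expAt≡0 : ∀ i mo → isZeroExp mo ≡ true → expAt i mo ≡ 0
isZeroExp⇒expAt≡0 i       []          _ = refl
isZeroExp⇒expAt≡0 zero    (zero ∷ mo) _ = refl
isZeroExp⇒expAt≡0 (suc i) (zero ∷ mo) z = isZeroExp⇒expAt≡0 i mo z

isZeroExp-decAt : ∀ i mo → isZeroExp mo ≡ true → isZeroExp (decAt i mo) ≡ true
isZeroExp-decAt i       []          _ = refl
isZeroExp-decAt zero    (zero ∷ mo) z = z
isZeroExp-decAt (suc i) (zero ∷ mo) z = isZeroExp-decAt i mo z

isZeroExp-monoEq : ∀ z m → isZeroExp z ≡ true → monoEq z m ≡ isZeroExp m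
isZeroExp-monoEq []         m           _ = refl
isZeroExp-monoEq (zero ∷ z) []          u = u
isZeroExp-monoEq (zero ∷ z) (zero ∷ m)  u = isZeroExp-monoEq z m u
isZeroExp-monoEq (zero ∷ z) (suc e ∷ m) _ = refl

univariate-incAt : ∀ mo → Univariate mo → Univariate (incAt 0 mo)
univariate-incAt []       _ = refl
univariate-incAt (e ∷ mo) u = u

univariate-decAt : ∀ i mo → Univariate mo → Univariate (decAt i mo)
univariate-decAt i       []       _ = refl
univariate-decAt zero    (e ∷ mo) u = u
univariate-decAt (suc i) (e ∷ mo) u = isZeroExp-decAt i mo u

univariate⇒expAt-suc≡0 : ∀ i mo → Univariate mo → expAt (suc i) mo ≡ 0
univariate⇒expAt-suc≡0 i []       _ = refl
univariate⇒expAt-suc≡0 i (e ∷ mo) u = isZeroExp⇒expAt≡0 i mo u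

monoEq-univariate : ∀ mo m → Univariate mo → monoEq mo m ≡ (expAt 0 mo ≡ᵇ expAt 0 m) ∧ isZeroExp (drop 1 m)
monoEq-univariate []            []          _ = refl
monoEq-univariate []            (zero ∷ m)  _ = refl
monoEq-univariate []            (suc e ∷ m) _ = refl
monoEq-univariate (zero ∷ mo)   []          u = u
monoEq-univariate (suc e ∷ mo)  []          _ = refl
monoEq-univariate (e ∷ mo)      (e′ ∷ m)    u = cong ((e ≡ᵇ e′) ∧_) (isZeroExp-monoEq mo m u)

univariateState-h-1 : ∀ {p} → UnivariateState p → UnivariateState (h-1 p)
univariateState-h-1 u = AllP.map⁺ (All.map (λ {x} → univariate-incAt (proj₂ x)) u)

univariateState-modeIdx : ∀ k {p} → UnivariateState p → UnivariateState (hmode (modeIdx k) p)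
univariateState-modeIdx zero          u = univariateState-h-1 u
univariateState-modeIdx (suc zero)    u = []
univariateState-modeIdx (suc (suc i)) u = AllP.map⁺ (All.map (λ {x} → univariate-decAt i (proj₂ x)) u)

univariateState-· : ∀ a {p} → UnivariateState p → UnivariateState (a · p)
univariateState-· a u = AllP.map⁺ u

univariateState-hbr-1 : ∀ {p} → UnivariateState p → UnivariateState (hbr-1 p)
univariateState-hbr-1 {p} u = AllP.concat⁺ (AllP.map⁺ (AllP.applyUpTo⁺₂ (λ k → k) (suc (suc (maxLen p)))
  (λ k → univariateState-· (c k) (univariateState-modeIdx k u))))

univariateState-iter : ∀ f → (∀ {p} → UnivariateState p → UnivariateState (f p)) → ∀ t → UnivariateState (iter t f vac)
univariateState-iter f pres zero    = refl ∷ []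
univariateState-iter f pres (suc t) = pres (univariateState-iter f pres t)

coeff-onAxis : ∀ {p} m → UnivariateState p → isZeroExp (drop 1 m) ≡ true → coeff p m ≡ coeff₁ p (expAt 0 m)
coeff-onAxis m []                  _      = refl
coeff-onAxis m (_∷_ {a , mo} u us) onAxis =
  cong₂ _+_ (cong (λ b → if b then a else 0ℚ) sameTest) (coeff-onAxis m us onAxis)
  where
  open ≡-Reasoning
  sameTest : monoEq mo m ≡ monoEq mo (expAt 0 m ∷ [])
  sameTest = begin
    monoEq mo m                                      ≡⟨ monoEq-univariate mo m u ⟩
    (expAt 0 mo ≡ᵇ expAt 0 m) ∧ isZeroExp (drop 1 m) ≡⟨ cong ((expAt 0 mo ≡ᵇ expAt 0 m) ∧_) onAxis ⟩
    (expAt 0 mo ≡ᵇ expAt 0 m) ∧ true                 ≡⟨ monoEq-univariate mo (expAt 0 m ∷ []) u ⟨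
    monoEq mo (expAt 0 m ∷ []) ∎

coeff-offAxis : ∀ {p} m → UnivariateState p → isZeroExp (drop 1 m) ≡ false → coeff p m ≡ 0ℚ
coeff-offAxis m []                  _       = refl
coeff-offAxis m (_∷_ {a , mo} u us) offAxis =
  trans (cong₂ _+_ (cong (λ b → if b then a else 0ℚ) noMatch) (coeff-offAxis m us offAxis)) (ℚP.+-identityʳ 0ℚ)
  where
  noMatch : monoEq mo m ≡ false
  noMatch = trans (monoEq-univariate mo m u) (trans (cong ((expAt 0 mo ≡ᵇ expAt 0 m) ∧_) offAxis) (BoolP.∧-zeroʳ _))

≈S-univariate : ∀ {p q} → UnivariateState p → UnivariateState q → (∀ n → coeff₁ p n ≡ coeff₁ q n) → p ≈S q
≈S-univariate up uq p≗q m with isZeroExp (drop 1 m) in onAxis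
... | true  = trans (coeff-onAxis m up onAxis) (trans (p≗q (expAt 0 m)) (sym (coeff-onAxis m uq onAxis)))
... | false = trans (coeff-offAxis m up onAxis) (sym (coeff-offAxis m uq onAxis))

-- The action of h[-1]

coeff-h[2+i] : ∀ i {p} m → UnivariateState p → coeff (hmode (+ suc (suc i)) p) m ≡ 0ℚ
coeff-h[2+i] i m []                  = refl
coeff-h[2+i] i m (_∷_ {a , mo} u us) = trans (cong₂ _+_ term≡0 (coeff-h[2+i] i m us)) (ℚP.+-identityʳ 0ℚ)
  where
  open ≡-Reasoning
  k = suc (suc i)
  b = monoEq (decAt (suc i) mo) m
  x = if b then a else 0ℚ
  term≡0 : (if b then ι (+ (k ℕ.* expAt (suc i) mo)) * a else 0ℚ) ≡ 0ℚ
  term≡0 = begin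
    (if b then ι (+ (k ℕ.* expAt (suc i) mo)) * a else 0ℚ) ≡⟨ if-*ˡ b (ι (+ (k ℕ.* expAt (suc i) mo))) a ⟩
    ι (+ (k ℕ.* expAt (suc i) mo)) * x                     ≡⟨ cong (λ e → ι (+ (k ℕ.* e)) * x) (univariate⇒expAt-suc≡0 i mo u) ⟩
    ι (+ (k ℕ.* 0)) * x                                    ≡⟨ cong (λ e → ι (+ e) * x) (ℕP.*-zeroʳ k) ⟩
    ι (+ 0) * x                                            ≡⟨ ℚP.*-zeroˡ x ⟩
    0ℚ ∎

-- The k = 1 summand c 1 · h(0) p of hbr-1 p is definitionally the empty state.
coeff₁-hbr-1 : ∀ {p} → UnivariateState p → ∀ n → coeff₁ (hbr-1 p) n ≡ hbr-1-seq (coeff₁ p) n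
coeff₁-hbr-1 {p} u n = begin
  coeff₁ (hbr-1 p) n                                ≡⟨ coeff-⊕ (F 0) (modesFrom 2 (maxLen p)) (n ∷ []) ⟩
  coeff₁ (F 0) n + coeff₁ (modesFrom 2 (maxLen p)) n ≡⟨ cong₂ _+_ h-1-part (h1-part (maxLen p) refl) ⟩
  mulX (coeff₁ p) n + c 2 * diff (coeff₁ p) n ∎
  where
  open ≡-Reasoning
  F : ℕ → State
  F k = c k · hmode (modeIdx k) p
  modesFrom : ℕ → ℕ → State
  modesFrom k₀ L = sumS (map F (applyUpTo (k₀ ℕ.+_) L))
  h-1-part : coeff₁ (F 0) n ≡ mulX (coeff₁ p) n
  h-1-part = trans (coeff-· 1ℚ (h-1 p) (n ∷ [])) (trans (ℚP.*-identityˡ _) (coeff₁-h-1 p n))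
  F[3+i]≡0 : ∀ i → coeff₁ (F (3 ℕ.+ i)) n ≡ 0ℚ
  F[3+i]≡0 i = begin
    coeff₁ (F (3 ℕ.+ i)) n                           ≡⟨ coeff-· (c (3 ℕ.+ i)) (hmode (+ suc (suc i)) p) (n ∷ []) ⟩
    c (3 ℕ.+ i) * coeff₁ (hmode (+ suc (suc i)) p) n ≡⟨ cong (c (3 ℕ.+ i) *_) (coeff-h[2+i] i (n ∷ []) u) ⟩
    c (3 ℕ.+ i) * 0ℚ                                 ≡⟨ ℚP.*-zeroʳ (c (3 ℕ.+ i)) ⟩
    0ℚ ∎
  modesFrom3≡0 : ∀ L → coeff₁ (modesFrom 3 L) n ≡ 0ℚ
  modesFrom3≡0 L = begin
    coeff₁ (modesFrom 3 L) n                ≡⟨ coeff-sumS-applyUpTo F (3 ℕ.+_) L (n ∷ []) ⟩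
    ∑[ k < L ] coeff₁ (F (3 ℕ.+ toℕ k)) n   ≡⟨ sum-cong-≗ {L} (F[3+i]≡0 ∘ toℕ) ⟩
    ∑[ k < L ] 0ℚ                           ≡⟨ sum-replicate-zero L ⟩
    0ℚ ∎
  -- hbr-1 truncates its sum at maxLen p; when that is 0 the h(1) term is missing, but p is constant.
  h1-part : ∀ L → maxLen p ≡ L → coeff₁ (modesFrom 2 L) n ≡ c 2 * diff (coeff₁ p) n
  h1-part zero    len≡0 = sym (begin
    c 2 * (ι (+ suc n) * coeff₁ p (suc n)) ≡⟨ cong (λ x → c 2 * (ι (+ suc n) * x)) (maxLen≡0⇒coeff₁-suc≡0 p n len≡0) ⟩
    c 2 * (ι (+ suc n) * 0ℚ)               ≡⟨ cong (c 2 *_) (ℚP.*-zeroʳ (ι (+ suc n))) ⟩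
    c 2 * 0ℚ                               ≡⟨ ℚP.*-zeroʳ (c 2) ⟩
    0ℚ ∎)
  h1-part (suc L) _     = begin
    coeff₁ (F 2 ⊕ modesFrom 3 L) n
      ≡⟨ coeff-⊕ (F 2) (modesFrom 3 L) (n ∷ []) ⟩
    coeff₁ (F 2) n + coeff₁ (modesFrom 3 L) n
      ≡⟨ cong₂ _+_ (trans (coeff-· (c 2) (hmode (+ 1) p) (n ∷ [])) (cong (c 2 *_) (coeff₁-h1 p n))) (modesFrom3≡0 L) ⟩
    c 2 * diff (coeff₁ p) n + 0ℚ
      ≡⟨ ℚP.+-identityʳ (c 2 * diff (coeff₁ p) n) ⟩
    c 2 * diff (coeff₁ p) n ∎

coeff₁-h-1^j : ∀ j n → coeff₁ (iter j h-1 vac) n ≡ δ j n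
coeff₁-h-1^j zero    zero    = refl
coeff₁-h-1^j zero    (suc n) = refl
coeff₁-h-1^j (suc j) zero    = coeff₁-h-1 (iter j h-1 vac) zero
coeff₁-h-1^j (suc j) (suc n) = trans (coeff₁-h-1 (iter j h-1 vac) (suc n)) (coeff₁-h-1^j j n)

coeff₁-rhs : ∀ t n → coeff₁ (rhs t) n ≡ rhsSeq t n
coeff₁-rhs t n = trans (coeff-sumS-applyUpTo summand (λ k → k) (suc t) (n ∷ [])) (sum-cong-≗ {suc t} (coeff₁-summand ∘ toℕ))
  where
  summand : ℕ → State
  summand k = rhsCoef t k · iter (t ∸ 2 ℕ.* k) h-1 vac
  coeff₁-summand : ∀ k → coeff₁ (summand k) n ≡ term t k n
  coeff₁-summand k = trans (coeff-· (rhsCoef t k) (iter (t ∸ 2 ℕ.* k) h-1 vac) (n ∷ []))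
                           (cong (rhsCoef t k *_) (coeff₁-h-1^j (t ∸ 2 ℕ.* k) n))

univariateState-rhs : ∀ t → UnivariateState (rhs t)
univariateState-rhs t = AllP.concat⁺ (AllP.map⁺ (AllP.applyUpTo⁺₂ (λ k → k) (suc t)
  (λ k → univariateState-· (rhsCoef t k) (univariateState-iter h-1 univariateState-h-1 (t ∸ 2 ℕ.* k)))))

univariateState-hbr-1^t : ∀ t → UnivariateState (iter t hbr-1 vac)
univariateState-hbr-1^t = univariateState-iter hbr-1 univariateState-hbr-1

coeff₁-hbr-1^t : ∀ t n → coeff₁ (iter t hbr-1 vac) n ≡ rhsSeq t n
coeff₁-hbr-1^t zero    n = trans (coeff₁-h-1^j 0 n) (sym (trans (ℚP.+-identityʳ (1ℚ * δ 0 n)) (ℚP.*-identityˡ (δ 0 n))))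
coeff₁-hbr-1^t (suc t) n = begin
  coeff₁ (hbr-1 (iter t hbr-1 vac)) n      ≡⟨ coeff₁-hbr-1 (univariateState-hbr-1^t t) n ⟩
  hbr-1-seq (coeff₁ (iter t hbr-1 vac)) n  ≡⟨ hbr-1-seq-cong (coeff₁-hbr-1^t t) n ⟩
  hbr-1-seq (rhsSeq t) n                   ≡⟨ rhsSeq-suc t n ⟨
  rhsSeq (suc t) n ∎
  where open ≡-Reasoning

lemma3p1 : (t : ℕ) → t % 2 ≡ 1 → iter t hbr-1 vac ≈S rhs t
lemma3p1 t _ = ≈S-univariate (univariateState-hbr-1^t t) (univariateState-rhs t)
  (λ n → trans (coeff₁-hbr-1^t t n) (sym (coeff₁-rhs t n)))
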